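{- Let $n\ge 6$ and let $\pi=(d_1,\ldots,d_n)$ be a graphic sequence with $d_n\ge 1$ and $\sigma(\pi)>2n$. Then $\pi$ has a realization containing $K_3\cup K_2$ or $P_5$ as a subgraph.
   Context: A non-increasing sequence of nonnegative integers is graphic if it is the degree sequence of a simple graph (a realization); $\sigma(\pi)=d_1+\cdots+d_n$. $P_5$ is the path on 5 vertices and $K_3\cup K_2$ is the disjoint union of a triangle and an edge. -}

module Defs where

open import Data.Nat using (ℕ; zero; suc; _+_; _≤_; _≥_; _>_; _*_)
open import Data.Fin using (Fin; toℕ; _<_)
open import Data.Bool using (Bool; true; false; if_then_else_)
open import Data.Product using (Σ; _×_; _,_; ∃)
open import Data.Sum using (_⊎_)
open import Relation.Binary.PropositionalEquality using (_≡_; refl)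
open import Data.Fin.Patterns
open import Function.Definitions using (Injective)

sumFin : (n : ℕ) → (Fin n → ℕ) → ℕ
sumFin zero    f = 0
sumFin (suc n) f = f Fin.zero + sumFin n (λ i → f (Fin.suc i))

record Graph (n : ℕ) : Set where
  field
    adj   : Fin n → Fin n → Bool
    sym   : ∀ i j → adj i j ≡ adj j i
    irref : ∀ i → adj i i ≡ false
open Graph public

deg : {n : ℕ} → Graph n → Fin n → ℕ
deg {n} G i = sumFin n (λ j → if adj G i j then 1 else 0)

Seq : ℕ → Set
Seq n = Fin n → ℕ

NonIncreasing : {n : ℕ} → Seq n → Set
NonIncreasing {n} d = ∀ (i j : Fin n) → i < j → d j ≤ d i

Realizes : {n : ℕ} → Graph n → Seq n → Set
Realizes {n} G d = ∀ (i : Fin n) → deg G i ≡ d i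

Graphic : {n : ℕ} → Seq n → Set
Graphic {n} d = NonIncreasing d × Σ (Graph n) (λ G → Realizes G d)

σ : {n : ℕ} → Seq n → ℕ
σ {n} d = sumFin n d

Contains : {n k : ℕ} → Graph n → Graph k → Set
Contains {n} {k} G H =
  Σ (Fin k → Fin n) (λ f →
    Injective _≡_ _≡_ f ×
    (∀ a b → adj H a b ≡ true → adj G (f a) (f b) ≡ true))

-- path P5: 0-1-2-3-4
P5-adj : Fin 5 → Fin 5 → Bool
P5-adj 0F 0F = false
P5-adj 0F 1F = true
P5-adj 0F 2F = false
P5-adj 0F 3F = false
P5-adj 0F 4F = false
P5-adj 1F 0F = true
P5-adj 1F 1F = false
P5-adj 1F 2F = true
P5-adj 1F 3F = false
P5-adj 1F 4F = false
P5-adj 2F 0F = false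
P5-adj 2F 1F = true
P5-adj 2F 2F = false
P5-adj 2F 3F = true
P5-adj 2F 4F = false
P5-adj 3F 0F = false
P5-adj 3F 1F = false
P5-adj 3F 2F = true
P5-adj 3F 3F = false
P5-adj 3F 4F = true
P5-adj 4F 0F = false
P5-adj 4F 1F = false
P5-adj 4F 2F = false
P5-adj 4F 3F = true
P5-adj 4F 4F = false

P5 : Graph 5
P5 = record { adj = P5-adj ; sym = s ; irref = r }
  where
  s : ∀ i j → P5-adj i j ≡ P5-adj j i
  s 0F 0F = refl
  s 0F 1F = refl
  s 0F 2F = refl
  s 0F 3F = refl
  s 0F 4F = refl
  s 1F 0F = refl
  s 1F 1F = refl
  s 1F 2F = refl
  s 1F 3F = refl
  s 1F 4F = refl
  s 2F 0F = refl
  s 2F 1F = refl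
  s 2F 2F = refl
  s 2F 3F = refl
  s 2F 4F = refl
  s 3F 0F = refl
  s 3F 1F = refl
  s 3F 2F = refl
  s 3F 3F = refl
  s 3F 4F = refl
  s 4F 0F = refl
  s 4F 1F = refl
  s 4F 2F = refl
  s 4F 3F = refl
  s 4F 4F = refl
  r : ∀ i → P5-adj i i ≡ false
  r 0F = refl
  r 1F = refl
  r 2F = refl
  r 3F = refl
  r 4F = refl

-- triangle {0,1,2} plus disjoint edge {3,4}
K3∪K2-adj : Fin 5 → Fin 5 → Bool
K3∪K2-adj 0F 0F = false
K3∪K2-adj 0F 1F = true
K3∪K2-adj 0F 2F = true
K3∪K2-adj 0F 3F = false
K3∪K2-adj 0F 4F = false
K3∪K2-adj 1F 0F = true
K3∪K2-adj 1F 1F = false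
K3∪K2-adj 1F 2F = true
K3∪K2-adj 1F 3F = false
K3∪K2-adj 1F 4F = false
K3∪K2-adj 2F 0F = true
K3∪K2-adj 2F 1F = true
K3∪K2-adj 2F 2F = false
K3∪K2-adj 2F 3F = false
K3∪K2-adj 2F 4F = false
K3∪K2-adj 3F 0F = false
K3∪K2-adj 3F 1F = false
K3∪K2-adj 3F 2F = false
K3∪K2-adj 3F 3F = false
K3∪K2-adj 3F 4F = true
K3∪K2-adj 4F 0F = false
K3∪K2-adj 4F 1F = false
K3∪K2-adj 4F 2F = false
K3∪K2-adj 4F 3F = true
K3∪K2-adj 4F 4F = false

K3∪K2 : Graph 5
K3∪K2 = record { adj = K3∪K2-adj ; sym = s ; irref = r }
  where
  s : ∀ i j → K3∪K2-adj i j ≡ K3∪K2-adj j i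
  s 0F 0F = refl
  s 0F 1F = refl
  s 0F 2F = refl
  s 0F 3F = refl
  s 0F 4F = refl
  s 1F 0F = refl
  s 1F 1F = refl
  s 1F 2F = refl
  s 1F 3F = refl
  s 1F 4F = refl
  s 2F 0F = refl
  s 2F 1F = refl
  s 2F 2F = refl
  s 2F 3F = refl
  s 2F 4F = refl
  s 3F 0F = refl
  s 3F 1F = refl
  s 3F 2F = refl
  s 3F 3F = refl
  s 3F 4F = refl
  s 4F 0F = refl
  s 4F 1F = refl
  s 4F 2F = refl
  s 4F 3F = refl
  s 4F 4F = refl
  r : ∀ i → K3∪K2-adj i i ≡ false
  r 0F = refl
  r 1F = refl
  r 2F = refl
  r 3F = refl
  r 4F = refl

module Submission where

-- Any realization G of π already contains K₃ ∪ K₂ or P₅; in fact this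
-- holds for every graph on n ≥ 5 vertices without isolated vertices whose
-- degree sum exceeds 2n.  The proof is a discharging argument: every edge
-- carries weight 2, split between its endpoints — all of it to an endpoint of
-- degree ≤ 1, nothing to an endpoint whose partner has degree ≤ 1, and 1 to
-- each endpoint otherwise.  By double counting the total charge is at least
-- the degree sum.  A vertex of degree ≤ 1 receives at most 2, and a vertex of
-- degree ≥ 2 receives more than 2 only if it has three distinct neighbours of
-- degree ≥ 2; a short case analysis then exhibits K₃ ∪ K₂ or P₅ around it.

open import Defs hiding (sym)
open import Data.Nat using (ℕ; zero; suc; _+_; _*_; _≤_; _<_; _>_; z≤n; s≤s; s≤s⁻¹; _≤?_)
open import Data.Nat.Properties
open import Data.Fin using (Fin; fromℕ) renaming (zero to fzero; suc to fsuc; _≟_ to _≟ᶠ_)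
open import Data.Fin.Properties using (any?; all?; ¬∀⟶∃¬; ≤fromℕ) renaming (≤∧≢⇒< to ≤∧≢⇒<ᶠ)
open import Data.Fin.Patterns
open import Data.Bool using (true; false; if_then_else_)
open import Data.List using (List; []; _∷_; length)
open import Data.List.Membership.Propositional using (_∈_; _∉_)
import Data.List.Membership.DecPropositional as DecMembership
open import Data.List.Relation.Unary.Any using (here; there)
open import Data.Vec using (Vec; lookup) renaming ([] to []ᵛ; _∷_ to _∷ᵛ_)
open import Data.Vec.Relation.Unary.All using () renaming ([] to []ᵃ; _∷_ to _∷ᵃ_)
open import Data.Vec.Relation.Unary.AllPairs using () renaming ([] to []ᵖ; _∷_ to _∷ᵖ_)
open import Data.Vec.Relation.Unary.Unique.Propositional using (Unique)
open import Data.Vec.Relation.Unary.Unique.Propositional.Properties using (lookup-injective)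
open import Data.Sum using (_⊎_; inj₁; inj₂)
open import Data.Product using (Σ; _×_; _,_; ∃)
open import Function using (_∘_)
open import Relation.Nullary using (yes; no; contradiction)
open import Relation.Nullary.Decidable using (_×-dec_)
open import Relation.Binary.PropositionalEquality
  using (_≡_; _≢_; refl; sym; trans; cong; cong₂; subst; ≢-sym; module ≡-Reasoning)
open import Algebra.Properties.CommutativeMonoid.Sum +-0-commutativeMonoid
  using (sum; sum-cong-≗; ∑-distrib-+; ∑-comm)

-- sumFin is the library's finite sum over the commutative monoid (ℕ, +, 0);
-- this bridge lets us reuse its distributivity and interchange laws.
sumFin≡sum : ∀ n (f : Fin n → ℕ) → sumFin n f ≡ sum f
sumFin≡sum zero    f = refl
sumFin≡sum (suc n) f = cong (f fzero +_) (sumFin≡sum n (f ∘ fsuc))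

sumFin-cong : ∀ n {f g : Fin n → ℕ} → (∀ i → f i ≡ g i) → sumFin n f ≡ sumFin n g
sumFin-cong zero    f≗g = refl
sumFin-cong (suc n) f≗g = cong₂ _+_ (f≗g fzero) (sumFin-cong n (f≗g ∘ fsuc))

sumFin-mono : ∀ n {f g : Fin n → ℕ} → (∀ i → f i ≤ g i) → sumFin n f ≤ sumFin n g
sumFin-mono zero    f≤g = z≤n
sumFin-mono (suc n) f≤g = +-mono-≤ (f≤g fzero) (sumFin-mono n (f≤g ∘ fsuc))

sumFin-const : ∀ n c → sumFin n (λ _ → c) ≡ n * c
sumFin-const zero    c = refl
sumFin-const (suc n) c = cong (c +_) (sumFin-const n c)

sumFin-zero : ∀ n → sumFin n (λ _ → 0) ≡ 0
sumFin-zero n = trans (sumFin-const n 0) (*-zeroʳ n)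

sumFin-ones : ∀ n → sumFin n (λ _ → 1) ≡ n
sumFin-ones n = trans (sumFin-const n 1) (*-identityʳ n)

sumFin-+ : ∀ n (f g : Fin n → ℕ) → sumFin n (λ i → f i + g i) ≡ sumFin n f + sumFin n g
sumFin-+ n f g = begin
  sumFin n (λ i → f i + g i)  ≡⟨ sumFin≡sum n _ ⟩
  sum (λ i → f i + g i)       ≡⟨ ∑-distrib-+ f g ⟩
  sum f + sum g               ≡⟨ sym (cong₂ _+_ (sumFin≡sum n f) (sumFin≡sum n g)) ⟩
  sumFin n f + sumFin n g     ∎
  where open ≡-Reasoning

ΣΣ : ∀ n → (Fin n → Fin n → ℕ) → ℕ
ΣΣ n f = sumFin n (λ x → sumFin n (f x))

ΣΣ≡sum : ∀ n (f : Fin n → Fin n → ℕ) → ΣΣ n f ≡ sum (λ x → sum (f x))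
ΣΣ≡sum n f = trans (sumFin≡sum n _) (sum-cong-≗ (λ x → sumFin≡sum n (f x)))

ΣΣ-transpose : ∀ n (f : Fin n → Fin n → ℕ) → ΣΣ n f ≡ ΣΣ n (λ x u → f u x)
ΣΣ-transpose n f = trans (ΣΣ≡sum n f) (trans (∑-comm f) (sym (ΣΣ≡sum n (λ x u → f u x))))

ΣΣ-symmetrize : ∀ n (f : Fin n → Fin n → ℕ) → ΣΣ n f + ΣΣ n f ≡ ΣΣ n (λ x u → f x u + f u x)
ΣΣ-symmetrize n f = begin
  ΣΣ n f + ΣΣ n f                                         ≡⟨ cong (ΣΣ n f +_) (ΣΣ-transpose n f) ⟩
  ΣΣ n f + ΣΣ n (λ x u → f u x)                           ≡⟨ sym (sumFin-+ n _ _) ⟩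
  sumFin n (λ x → sumFin n (f x) + sumFin n (λ u → f u x)) ≡⟨ sumFin-cong n (λ x → sym (sumFin-+ n _ _)) ⟩
  ΣΣ n (λ x u → f x u + f u x)                            ∎
  where open ≡-Reasoning

halve : ∀ {a b} → a + a ≤ b + b → a ≤ b
halve {a} {b} a+a≤b+b with a ≤? b
... | yes a≤b = a≤b
... | no  a≰b = contradiction a+a≤b+b (<⇒≱ (+-mono-< (≰⇒> a≰b) (≰⇒> a≰b)))

double-counting : ∀ n (f g : Fin n → Fin n → ℕ) →
  (∀ x u → f x u + f u x ≤ g x u + g u x) → ΣΣ n f ≤ ΣΣ n g
double-counting n f g pairwise = halve (begin
  ΣΣ n f + ΣΣ n f               ≡⟨ ΣΣ-symmetrize n f ⟩
  ΣΣ n (λ x u → f x u + f u x)  ≤⟨ sumFin-mono n (λ x → sumFin-mono n (pairwise x)) ⟩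
  ΣΣ n (λ x u → g x u + g u x)  ≡⟨ sym (ΣΣ-symmetrize n g) ⟩
  ΣΣ n g + ΣΣ n g               ∎)
  where open ≤-Reasoning

δ : ∀ {n} → Fin n → Fin n → ℕ
δ fzero    fzero    = 1
δ fzero    (fsuc _) = 0
δ (fsuc _) fzero    = 0
δ (fsuc a) (fsuc b) = δ a b

δ-refl : ∀ {n} (a : Fin n) → δ a a ≡ 1
δ-refl fzero    = refl
δ-refl (fsuc a) = δ-refl a

sum-δ : ∀ n (a : Fin n) → sumFin n (δ a) ≡ 1
sum-δ (suc n) fzero    = cong suc (sumFin-zero n)
sum-δ (suc n) (fsuc a) = sum-δ n a

multiplicity : ∀ {n} → List (Fin n) → Fin n → ℕ
multiplicity []       i = 0
multiplicity (x ∷ xs) i = δ x i + multiplicity xs i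

sum-multiplicity : ∀ n (xs : List (Fin n)) → sumFin n (multiplicity xs) ≡ length xs
sum-multiplicity n []       = sumFin-zero n
sum-multiplicity n (x ∷ xs) =
  trans (sumFin-+ n (δ x) (multiplicity xs)) (cong₂ _+_ (sum-δ n x) (sum-multiplicity n xs))

multiplicity-∈ : ∀ {n} {i : Fin n} {xs} → i ∈ xs → 1 ≤ multiplicity xs i
multiplicity-∈ {i = i} {xs = _ ∷ xs} (here refl) =
  ≤-trans (≤-reflexive (sym (δ-refl i))) (m≤m+n _ (multiplicity xs i))
multiplicity-∈ (there i∈xs) = ≤-trans (multiplicity-∈ i∈xs) (m≤n+m _ _)

module _ {n : ℕ} where
  open DecMembership (_≟ᶠ_ {n}) using (_∈?_; _∉?_)

  pigeonhole : (f : Fin n → ℕ) → (∀ i → f i ≤ 1) → (xs : List (Fin n)) →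
    length xs < sumFin n f → ∃ λ i → i ∉ xs × 1 ≤ f i
  pigeonhole f f≤1 xs long with any? (λ i → (i ∉? xs) ×-dec (1 ≤? f i))
  ... | yes found = found
  ... | no  none  = contradiction long (≤⇒≯ (begin
    sumFin n f                   ≤⟨ sumFin-mono n f≤multiplicity ⟩
    sumFin n (multiplicity xs)   ≡⟨ sum-multiplicity n xs ⟩
    length xs                    ∎))
    where
    open ≤-Reasoning
    f≤multiplicity : ∀ i → f i ≤ multiplicity xs i
    f≤multiplicity i with i ∈? xs
    ... | yes i∈xs = ≤-trans (f≤1 i) (multiplicity-∈ i∈xs)
    ... | no  i∉xs = ≤-trans (s≤s⁻¹ (≰⇒> (λ 1≤fi → none (i , i∉xs , 1≤fi)))) z≤n

-- Share of an edge's weight 2 received by an endpoint of degree a whose other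
-- endpoint has degree c: leaves take everything, otherwise the edge is halved.
portion : ℕ → ℕ → ℕ
portion 0             c             = 2
portion 1             c             = 2
portion (suc (suc a)) 0             = 0
portion (suc (suc a)) 1             = 0
portion (suc (suc a)) (suc (suc c)) = 1

portion-pair : ∀ a c → 2 ≤ portion a c + portion c a
portion-pair 0             c             = m≤m+n 2 (portion c 0)
portion-pair 1             c             = m≤m+n 2 (portion c 1)
portion-pair (suc (suc a)) 0             = ≤-refl
portion-pair (suc (suc a)) 1             = ≤-refl
portion-pair (suc (suc a)) (suc (suc c)) = ≤-refl

portion≤2 : ∀ a c → portion a c ≤ 2
portion≤2 0             c             = ≤-refl
portion≤2 1             c             = ≤-refl
portion≤2 (suc (suc a)) 0             = z≤n
portion≤2 (suc (suc a)) 1             = z≤n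
portion≤2 (suc (suc a)) (suc (suc c)) = s≤s z≤n

portion-halved : ∀ {a} c → 2 ≤ a → portion a c ≤ 1
portion-halved 0             (s≤s (s≤s _)) = z≤n
portion-halved 1             (s≤s (s≤s _)) = z≤n
portion-halved (suc (suc c)) (s≤s (s≤s _)) = ≤-refl

portion-pos : ∀ {a} c → 2 ≤ a → 1 ≤ portion a c → 2 ≤ c
portion-pos 0             (s≤s (s≤s _)) ()
portion-pos 1             (s≤s (s≤s _)) ()
portion-pos (suc (suc c)) (s≤s (s≤s _)) _ = s≤s (s≤s z≤n)

module GraphFacts {n : ℕ} (G : Graph n) where

  Edge : Fin n → Fin n → Set
  Edge x u = adj G x u ≡ true

  A : Fin n → Fin n → ℕ
  A x u = if adj G x u then 1 else 0

  Found : Set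
  Found = Contains G K3∪K2 ⊎ Contains G P5

  Edge-sym : ∀ {x u} → Edge x u → Edge u x
  Edge-sym {x} {u} xu = trans (Graph.sym G u x) xu

  Edge⇒≢ : ∀ {x u} → Edge x u → x ≢ u
  Edge⇒≢ {x} xx refl = contradiction (trans (sym (irref G x)) xx) λ ()

  non-neighbour-≢ : ∀ {a b c} → adj G a b ≡ false → Edge a c → b ≢ c
  non-neighbour-≢ ab ac refl = contradiction (trans (sym ab) ac) λ ()

  A≤1 : ∀ x u → A x u ≤ 1
  A≤1 x u with adj G x u
  ... | true  = ≤-refl
  ... | false = z≤n

  A-pos : ∀ x u → 1 ≤ A x u → Edge x u
  A-pos x u pos with adj G x u
  ... | true  = refl
  ... | false = contradiction pos λ ()

  neighbour-outside : ∀ u (xs : List (Fin n)) → length xs < deg G u → ∃ λ w → w ∉ xs × Edge u w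
  neighbour-outside u xs long with pigeonhole (A u) (A≤1 u) xs long
  ... | w , w∉xs , pos = w , w∉xs , A-pos u w pos

  other-neighbour : ∀ u x → 2 ≤ deg G u → ∃ λ w → w ≢ x × Edge u w
  other-neighbour u x big with neighbour-outside u (x ∷ []) big
  ... | w , w∉ , uw = w , w∉ ∘ here , uw

  embed : (H : Graph 5) (v : Vec (Fin n) 5) → Unique v →
    (∀ i j → adj H i j ≡ true → Edge (lookup v i) (lookup v j)) → Contains G H
  embed H v distinct edges = lookup v , (λ {i} {j} → lookup-injective distinct i j) , edges

  -- A path a-b-c-d-e; consecutive vertices are distinct automatically.
  path5 : ∀ a b c d e → a ≢ c → a ≢ d → a ≢ e → b ≢ d → b ≢ e → c ≢ e →
    Edge a b → Edge b c → Edge c d → Edge d e → Found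
  path5 a b c d e a≢c a≢d a≢e b≢d b≢e c≢e ab bc cd de = inj₂ (embed P5 vertices
    ((Edge⇒≢ ab ∷ᵃ a≢c ∷ᵃ a≢d ∷ᵃ a≢e ∷ᵃ []ᵃ) ∷ᵖ (Edge⇒≢ bc ∷ᵃ b≢d ∷ᵃ b≢e ∷ᵃ []ᵃ) ∷ᵖ
     (Edge⇒≢ cd ∷ᵃ c≢e ∷ᵃ []ᵃ) ∷ᵖ (Edge⇒≢ de ∷ᵃ []ᵃ) ∷ᵖ []ᵃ ∷ᵖ []ᵖ)
    edges)
    where
    vertices : Vec (Fin n) 5
    vertices = a ∷ᵛ b ∷ᵛ c ∷ᵛ d ∷ᵛ e ∷ᵛ []ᵛ
    edges : ∀ i j → adj P5 i j ≡ true → Edge (lookup vertices i) (lookup vertices j)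
    edges 0F 1F _ = ab
    edges 1F 0F _ = Edge-sym ab
    edges 1F 2F _ = bc
    edges 2F 1F _ = Edge-sym bc
    edges 2F 3F _ = cd
    edges 3F 2F _ = Edge-sym cd
    edges 3F 4F _ = de
    edges 4F 3F _ = Edge-sym de
    edges 0F 0F ()
    edges 0F 2F ()
    edges 0F 3F ()
    edges 0F 4F ()
    edges 1F 1F ()
    edges 1F 3F ()
    edges 1F 4F ()
    edges 2F 0F ()
    edges 2F 2F ()
    edges 2F 4F ()
    edges 3F 0F ()
    edges 3F 1F ()
    edges 3F 3F ()
    edges 4F 0F ()
    edges 4F 1F ()
    edges 4F 2F ()
    edges 4F 4F ()

  triangle+edge : ∀ a b c d e → a ≢ d → a ≢ e → b ≢ d → b ≢ e → c ≢ d → c ≢ e →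
    Edge a b → Edge a c → Edge b c → Edge d e → Found
  triangle+edge a b c d e a≢d a≢e b≢d b≢e c≢d c≢e ab ac bc de = inj₁ (embed K3∪K2 vertices
    ((Edge⇒≢ ab ∷ᵃ Edge⇒≢ ac ∷ᵃ a≢d ∷ᵃ a≢e ∷ᵃ []ᵃ) ∷ᵖ (Edge⇒≢ bc ∷ᵃ b≢d ∷ᵃ b≢e ∷ᵃ []ᵃ) ∷ᵖ
     (c≢d ∷ᵃ c≢e ∷ᵃ []ᵃ) ∷ᵖ (Edge⇒≢ de ∷ᵃ []ᵃ) ∷ᵖ []ᵃ ∷ᵖ []ᵖ)
    edges)
    where
    vertices : Vec (Fin n) 5
    vertices = a ∷ᵛ b ∷ᵛ c ∷ᵛ d ∷ᵛ e ∷ᵛ []ᵛ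
    edges : ∀ i j → adj K3∪K2 i j ≡ true → Edge (lookup vertices i) (lookup vertices j)
    edges 0F 1F _ = ab
    edges 1F 0F _ = Edge-sym ab
    edges 0F 2F _ = ac
    edges 2F 0F _ = Edge-sym ac
    edges 1F 2F _ = bc
    edges 2F 1F _ = Edge-sym bc
    edges 3F 4F _ = de
    edges 4F 3F _ = Edge-sym de
    edges 0F 0F ()
    edges 0F 3F ()
    edges 0F 4F ()
    edges 1F 1F ()
    edges 1F 3F ()
    edges 1F 4F ()
    edges 2F 2F ()
    edges 2F 3F ()
    edges 2F 4F ()
    edges 3F 0F ()
    edges 3F 1F ()
    edges 3F 2F ()
    edges 3F 3F ()
    edges 4F 0F ()
    edges 4F 1F ()
    edges 4F 2F ()
    edges 4F 4F ()

  share : Fin n → Fin n → ℕ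
  share x u = if adj G x u then portion (deg G x) (deg G u) else 0

  charge : Fin n → ℕ
  charge x = sumFin n (share x)

  share-pair : ∀ x u → A x u + A u x ≤ share x u + share u x
  share-pair x u rewrite Graph.sym G u x with adj G x u
  ... | true  = portion-pair (deg G x) (deg G u)
  ... | false = z≤n

  σ≤total-charge : σ (deg G) ≤ sumFin n charge
  σ≤total-charge = double-counting n A share share-pair

  low-degree-charge : ∀ x → deg G x ≤ 1 → charge x ≤ 2
  low-degree-charge x deg≤1 = begin
    charge x                                ≤⟨ sumFin-mono n share≤2A ⟩
    sumFin n (λ u → A x u + A x u)          ≡⟨ sumFin-+ n (A x) (A x) ⟩
    deg G x + deg G x                       ≤⟨ +-mono-≤ deg≤1 deg≤1 ⟩
    2                                       ∎
    where
    open ≤-Reasoning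
    share≤2A : ∀ u → share x u ≤ A x u + A x u
    share≤2A u with adj G x u
    ... | true  = portion≤2 (deg G x) (deg G u)
    ... | false = z≤n

  share-halved : ∀ x → 2 ≤ deg G x → ∀ u → share x u ≤ 1
  share-halved x deg≥2 u with adj G x u
  ... | true  = portion-halved (deg G u) deg≥2
  ... | false = z≤n

  share-pos : ∀ x u → 2 ≤ deg G x → 1 ≤ share x u → Edge x u × 2 ≤ deg G u
  share-pos x u deg≥2 pos with adj G x u
  ... | true  = refl , portion-pos (deg G u) deg≥2 pos
  ... | false = contradiction pos λ ()

  heavy-neighbour : ∀ x → 2 ≤ deg G x → (xs : List (Fin n)) → length xs < charge x →
    ∃ λ u → u ∉ xs × Edge x u × 2 ≤ deg G u
  heavy-neighbour x deg≥2 xs long with pigeonhole (share x) (share-halved x deg≥2) xs long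
  ... | u , u∉xs , pos = u , u∉xs , share-pos x u deg≥2 pos

  module _ (n≥5 : 5 ≤ n) (no-isolated : ∀ i → 1 ≤ deg G i) where

    fifth-vertex : ∀ a b c d → ∃ λ y → y ≢ a × y ≢ b × y ≢ c × y ≢ d
    fifth-vertex a b c d
      with pigeonhole {n} (λ _ → 1) (λ _ → ≤-refl) (a ∷ b ∷ c ∷ d ∷ []) (subst (4 <_) (sym (sumFin-ones n)) n≥5)
    ... | y , y∉ , _ =
      y , y∉ ∘ here , y∉ ∘ there ∘ here , y∉ ∘ there ∘ there ∘ here , y∉ ∘ there ∘ there ∘ there ∘ here

    -- A diamond: triangle xst plus a vertex r adjacent to x and s.  An edge yz
    -- at a fifth vertex y either extends it to a P₅ or lies beside the triangle.
    diamond : ∀ x s t r → t ≢ r →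
      Edge x s → Edge x t → Edge x r → Edge s t → Edge r s → Found
    diamond x s t r t≢r xs xt xr st rs with fifth-vertex x s t r
    ... | y , y≢x , y≢s , y≢t , y≢r with neighbour-outside y [] (no-isolated y)
    ... | z , _ , yz with z ≟ᶠ x | z ≟ᶠ s | z ≟ᶠ t | z ≟ᶠ r
    ... | yes refl | _ | _ | _ =
      path5 y x r s t y≢r y≢s y≢t (Edge⇒≢ xs) (Edge⇒≢ xt) (≢-sym t≢r) yz xr rs st
    ... | _ | yes refl | _ | _ =
      path5 y s t x r y≢t y≢x y≢r (Edge⇒≢ (Edge-sym xs)) (Edge⇒≢ (Edge-sym rs)) t≢r yz st (Edge-sym xt) xr
    ... | _ | _ | yes refl | _ =
      path5 y t s r x y≢s y≢r y≢x t≢r (Edge⇒≢ (Edge-sym xt)) (Edge⇒≢ (Edge-sym xs))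
        yz (Edge-sym st) (Edge-sym rs) (Edge-sym xr)
    ... | _ | _ | _ | yes refl =
      path5 y r x t s y≢x y≢t y≢s (≢-sym t≢r) (Edge⇒≢ rs) (Edge⇒≢ xs) yz (Edge-sym xr) xt (Edge-sym st)
    ... | no z≢x | no z≢s | no z≢t | no z≢r =
      triangle+edge x s t y z (≢-sym y≢x) (≢-sym z≢x) (≢-sym y≢s) (≢-sym z≢s) (≢-sym y≢t) (≢-sym z≢t) xs xt st yz

    -- A triangle xpq with a further neighbour r of x and a neighbour w ≠ x of r:
    -- either w closes a diamond, or w-r-x-p-q is a P₅.
    triangle-with-tail : ∀ x p q r w → r ≢ p → r ≢ q → w ≢ x →
      Edge x p → Edge x q → Edge p q → Edge x r → Edge r w → Found
    triangle-with-tail x p q r w r≢p r≢q w≢x xp xq pq xr rw with w ≟ᶠ p | w ≟ᶠ q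
    ... | yes refl | _ = diamond x p q r (≢-sym r≢q) xp xq xr pq rw
    ... | _ | yes refl = diamond x q p r (≢-sym r≢p) xq xp xr (Edge-sym pq) rw
    ... | no w≢p | no w≢q = path5 w r x p q w≢x w≢p w≢q r≢p r≢q (Edge⇒≢ xq) (Edge-sym rw) (Edge-sym xr) xp pq

    -- Three pairwise non-adjacent neighbours u₁,u₂,u₃ of x, with neighbours
    -- w₁ ≠ x of u₁ and w₂ ≠ x of u₂: w₁-u₁-x-u₂-w₂ or u₃-x-u₁-w-u₂ is a P₅.
    claw : ∀ x u₁ u₂ u₃ w₁ w₂ → u₂ ≢ u₁ → u₃ ≢ u₁ → u₃ ≢ u₂ →
      adj G u₁ u₂ ≡ false → adj G u₁ u₃ ≡ false →
      Edge x u₁ → Edge x u₂ → Edge x u₃ → w₁ ≢ x → w₂ ≢ x → Edge u₁ w₁ → Edge u₂ w₂ → Found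
    claw x u₁ u₂ u₃ w₁ w₂ u₂≢u₁ u₃≢u₁ u₃≢u₂ u₁≁u₂ u₁≁u₃ xu₁ xu₂ xu₃ w₁≢x w₂≢x u₁w₁ u₂w₂ with w₁ ≟ᶠ w₂
    ... | no w₁≢w₂ =
      path5 w₁ u₁ x u₂ w₂ w₁≢x (≢-sym (non-neighbour-≢ u₁≁u₂ u₁w₁)) w₁≢w₂ (≢-sym u₂≢u₁)
        (non-neighbour-≢ (trans (Graph.sym G u₂ u₁) u₁≁u₂) u₂w₂) (≢-sym w₂≢x)
        (Edge-sym u₁w₁) (Edge-sym xu₁) xu₂ u₂w₂
    ... | yes refl =
      path5 u₃ x u₁ w₁ u₂ u₃≢u₁ (non-neighbour-≢ u₁≁u₃ u₁w₁) u₃≢u₂ (≢-sym w₁≢x) (Edge⇒≢ xu₂) (≢-sym u₂≢u₁)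
        (Edge-sym xu₃) xu₁ u₁w₁ (Edge-sym u₂w₂)

    rich-vertex : ∀ x u₁ u₂ u₃ → u₂ ≢ u₁ → u₃ ≢ u₁ → u₃ ≢ u₂ →
      Edge x u₁ → Edge x u₂ → Edge x u₃ → 2 ≤ deg G u₁ → 2 ≤ deg G u₂ → 2 ≤ deg G u₃ → Found
    rich-vertex x u₁ u₂ u₃ u₂≢u₁ u₃≢u₁ u₃≢u₂ xu₁ xu₂ xu₃ big₁ big₂ big₃
      with other-neighbour u₁ x big₁ | other-neighbour u₂ x big₂ | other-neighbour u₃ x big₃
         | adj G u₁ u₂ in u₁u₂ | adj G u₁ u₃ in u₁u₃ | adj G u₂ u₃ in u₂u₃
    ... | _ | _ | w₃ , w₃≢x , u₃w₃ | true | _ | _ =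
      triangle-with-tail x u₁ u₂ u₃ w₃ u₃≢u₁ u₃≢u₂ w₃≢x xu₁ xu₂ u₁u₂ xu₃ u₃w₃
    ... | _ | w₂ , w₂≢x , u₂w₂ | _ | _ | true | _ =
      triangle-with-tail x u₁ u₃ u₂ w₂ u₂≢u₁ (≢-sym u₃≢u₂) w₂≢x xu₁ xu₃ u₁u₃ xu₂ u₂w₂
    ... | w₁ , w₁≢x , u₁w₁ | _ | _ | _ | _ | true =
      triangle-with-tail x u₂ u₃ u₁ w₁ (≢-sym u₂≢u₁) (≢-sym u₃≢u₁) w₁≢x xu₂ xu₃ u₂u₃ xu₁ u₁w₁
    ... | w₁ , w₁≢x , u₁w₁ | w₂ , w₂≢x , u₂w₂ | _ | false | false | false =
      claw x u₁ u₂ u₃ w₁ w₂ u₂≢u₁ u₃≢u₁ u₃≢u₂ u₁u₂ u₁u₃ xu₁ xu₂ xu₃ w₁≢x w₂≢x u₁w₁ u₂w₂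

    -- A vertex of degree ≥ 2 and charge > 2 has three distinct heavy neighbours.
    overcharged-branching : ∀ x → 2 ≤ deg G x → 2 < charge x → Found
    overcharged-branching x deg≥2 over with heavy-neighbour x deg≥2 [] (≤-trans (s≤s z≤n) over)
    ... | u₁ , _ , xu₁ , big₁ with heavy-neighbour x deg≥2 (u₁ ∷ []) (≤-trans (s≤s (s≤s z≤n)) over)
    ... | u₂ , u₂∉ , xu₂ , big₂ with heavy-neighbour x deg≥2 (u₁ ∷ u₂ ∷ []) over
    ... | u₃ , u₃∉ , xu₃ , big₃ =
      rich-vertex x u₁ u₂ u₃ (u₂∉ ∘ here) (u₃∉ ∘ here) (u₃∉ ∘ there ∘ here) xu₁ xu₂ xu₃ big₁ big₂ big₃

    overcharged : ∀ x → 2 < charge x → Found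
    overcharged x over with deg G x ≤? 1
    ... | yes deg≤1 = contradiction (low-degree-charge x deg≤1) (<⇒≱ over)
    ... | no  deg≰1 = overcharged-branching x (≰⇒> deg≰1) over

    dense⇒pattern : 2 * n < σ (deg G) → Found
    dense⇒pattern dense with all? (λ x → charge x ≤? 2)
    ... | yes bounded = contradiction dense (≤⇒≯ (begin
      σ (deg G)                  ≤⟨ σ≤total-charge ⟩
      sumFin n charge            ≤⟨ sumFin-mono n bounded ⟩
      sumFin n (λ _ → 2)         ≡⟨ sumFin-const n 2 ⟩
      n * 2                      ≡⟨ *-comm n 2 ⟩
      2 * n                      ∎))
      where open ≤-Reasoning
    ... | no unbounded with ¬∀⟶∃¬ n (λ x → charge x ≤ 2) (λ x → charge x ≤? 2) unbounded
    ... | x , charge≰2 = overcharged x (≰⇒> charge≰2)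

all-positive : ∀ m (d : Seq (suc m)) → NonIncreasing d → 1 ≤ d (fromℕ m) → ∀ i → 1 ≤ d i
all-positive m d nonincreasing last≥1 i with i ≟ᶠ fromℕ m
... | yes refl = last≥1
... | no  i≢last = ≤-trans last≥1 (nonincreasing i (fromℕ m) (≤∧≢⇒<ᶠ (≤fromℕ i) i≢last))

lemma3p6 : (m : ℕ) → 6 ≤ suc m → (d : Seq (suc m)) → Graphic d →
    1 ≤ d (fromℕ m) → σ d > 2 * suc m →
    Σ (Graph (suc m)) (λ G → Realizes G d × (Contains G K3∪K2 ⊎ Contains G P5))
lemma3p6 m n≥6 d (nonincreasing , G , realizes) last≥1 σ>2n =
  G , realizes , GraphFacts.dense⇒pattern G (≤-trans (n≤1+n 5) n≥6) no-isolated dense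
  where
  no-isolated : ∀ i → 1 ≤ deg G i
  no-isolated i = subst (1 ≤_) (sym (realizes i)) (all-positive m d nonincreasing last≥1 i)
  dense : 2 * suc m < σ (deg G)
  dense = subst (2 * suc m <_) (sumFin-cong (suc m) (sym ∘ realizes)) σ>2n
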